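{- Every chordal graph $G$ is fully orientable.
   Context: All graphs are finite, without loops or multiple edges. An orientation of $G$ assigns a direction to each edge; it is acyclic if it contains no directed cycle. In an acyclic orientation $D$, an arc is called dependent if reversing it creates a directed cycle (equivalently, $u\to v$ is dependent iff there is a directed walk of length at least two from $u$ to $v$). $d(D)$ is the number of dependent arcs of $D$; $d_{\min}(G)$ and $d_{\max}(G)$ are the minimum and maximum of $d(D)$ over all acyclic orientations $D$ of $G$. $G$ is fully orientable if for every integer $d$ with $d_{\min}(G)\le d\le d_{\max}(G)$ there is an acyclic orientation $D$ of $G$ with $d(D)=d$. A graph is chordal if every cycle of length at least four has a chord (an edge joining two non-consecutive vertices of the cycle). -}

module Defs where

open import Data.Nat using (ℕ; zero; suc; _<_; _≤_)
open import Data.Fin using (Fin; toℕ)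
open import Data.Bool using (Bool; true; false; not)
open import Data.Product using (Σ; ∃; _×_; _,_)
open import Data.List using (List; length)
open import Data.List.Membership.Propositional using (_∈_)
open import Data.List.Relation.Unary.Unique.Propositional using (Unique)
open import Function.Bundles using (_⇔_)
open import Function.Definitions using (Injective)
open import Relation.Binary.PropositionalEquality using (_≡_; _≢_)
open import Relation.Nullary using (¬_)

record Graph : Set where
  field
    n     : ℕ
    adj   : Fin n → Fin n → Bool
    sym   : ∀ u v → adj u v ≡ adj v u
    loopless : ∀ v → adj v v ≡ false

module _ (G : Graph) where
  open Graph G

  Adj : Fin n → Fin n → Set
  Adj u v = adj u v ≡ true

  record Orientation : Set where
    field
      arc      : Fin n → Fin n → Bool
      arc⇒edge : ∀ u v → arc u v ≡ true → Adj u v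
      oneDir   : ∀ u v → Adj u v → arc u v ≡ not (arc v u)

  open Orientation public

  data Walk (D : Orientation) : Fin n → Fin n → ℕ → Set where
    here : ∀ {v} → Walk D v v zero
    step : ∀ {u w v k} → arc D u w ≡ true → Walk D w v k → Walk D u v (suc k)

  Acyclic : Orientation → Set
  Acyclic D = ∀ v k → ¬ Walk D v v (suc k)

  Dependent : Orientation → Fin n × Fin n → Set
  Dependent D (u , v) = (arc D u v ≡ true) × (∃ λ k → Walk D u v (suc (suc k)))

  NumDependent : Orientation → ℕ → Set
  NumDependent D k = Σ (List (Fin n × Fin n)) λ L →
    Unique L × (∀ p → (p ∈ L) ⇔ Dependent D p) × (length L ≡ k)

  -- Fully orientable: every d with d_min ≤ d ≤ d_max is attained.
  -- d_min ≤ d ⇔ some acyclic D₁ has d(D₁) ≤ d; d ≤ d_max ⇔ some acyclic D₂ has d ≤ d(D₂).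
  FullyOrientable : Set
  FullyOrientable = ∀ (d : ℕ) (D₁ D₂ : Orientation) (a b : ℕ) →
    Acyclic D₁ → NumDependent D₁ a → Acyclic D₂ → NumDependent D₂ b →
    a ≤ d → d ≤ b →
    Σ Orientation λ D → Acyclic D × NumDependent D d

  record Cycle (k : ℕ) : Set where
    field
      vert  : Fin k → Fin n
      inj   : Injective _≡_ _≡_ vert
      next  : ∀ i j → suc (toℕ i) ≡ toℕ j → Adj (vert i) (vert j)
      wrap  : ∀ i j → toℕ i ≡ 0 → suc (toℕ j) ≡ k → Adj (vert j) (vert i)

  HasChord : ∀ {k} → Cycle k → Set
  HasChord {k} C = ∃ λ (i : Fin k) → ∃ λ (j : Fin k) →
    (toℕ i < toℕ j) × (suc (toℕ i) ≢ toℕ j) × ¬ ((toℕ i ≡ 0) × (suc (toℕ j) ≡ k))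
    × Adj (Cycle.vert C i) (Cycle.vert C j)

  Chordal : Set
  Chordal = ∀ k → 4 ≤ k → (C : Cycle k) → HasChord C

module Submission where

-- A chordal graph has a perfect elimination ordering: by Dirac's argument every induced subgraph has
-- a simplicial vertex outside any given clique, so the vertices can be listed as s ∷ X′ where the t
-- neighbours of s in X′ form a clique.  For an acyclic orientation D, passing from X′ to s ∷ X′
-- increases the number of dependent arcs of the induced orientation by at least t − 2 (every arc at
-- s is dependent except at most one out-arc and one in-arc) and by at most t (besides the arcs at s,
-- at most one arc a → b becomes dependent, through a → s → b, and then s → b is not dependent),
-- while directing every edge at s away from s adds exactly t − 1.  So if d lies strictly between the
-- counts of D₁ and D₂ on s ∷ X′, then d − (t − 1) lies between their counts on X′; it is realised
-- there by induction, and making s a source realises d.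

open import Data.Bool using (Bool; true; false; not)
import Data.Bool.Properties as Bool
open import Data.Empty using (⊥; ⊥-elim)
open import Data.Fin using (Fin; zero; suc; toℕ; fromℕ<; _≟_)
open import Data.Fin.Properties using (any?; pigeonhole; toℕ<n; toℕ-fromℕ<; toℕ-mono-<; toℕ≤pred[n]; toℕ-injective)
open import Data.List using (List; []; _∷_; length; filter; allFin; cartesianProduct)
import Data.List as List
open import Data.List.Properties using (length-++; length-map)
open import Data.List.Membership.Propositional using (_∈_; _∉_)
open import Data.List.Membership.Propositional.Properties
  using (∈-filter⁺; ∈-filter⁻; ∈-map⁺; ∈-map⁻; ∈-++⁺ˡ; ∈-++⁺ʳ; ∈-++⁻; ∈-allFin; ∈-cartesianProduct⁺)
open import Data.List.Membership.Propositional.Properties.WithK using (unique∧set⇒bag)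
open import Data.List.Relation.Binary.BagAndSetEquality using (∼bag⇒↭)
open import Data.List.Relation.Binary.Permutation.Propositional.Properties using (↭-length)
open import Data.List.Relation.Unary.Any using (here; there)
import Data.List.Relation.Unary.All as All
open import Data.List.Relation.Unary.Unique.Propositional using (Unique; []; _∷_)
open import Data.List.Relation.Unary.Unique.Propositional.Properties
  using (filter⁺; ++⁺; map⁺; allFin⁺; cartesianProduct⁺)
open import Data.Nat using (ℕ; zero; suc; _+_; _∸_; _≤_; _<_; z≤n; s≤s)
import Data.Nat as ℕ
open import Data.Nat.Induction using (<-rec)
open import Data.Nat.Properties
  using (≤-refl; ≤-trans; ≤-reflexive; ≤-pred; <⇒≤; ≮⇒≥; <-≤-trans; <-cmp; n≤1+n; ≤∧≢⇒<; n≤0⇒n≡0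
        ; suc-injective; +-comm; +-suc; +-identityʳ; m≤m+n; +-mono-≤; +-monoˡ-≤; +-monoʳ-≤; +-monoʳ-<
        ; +-monoˡ-<; m+[n∸m]≡n; m≤n+m∸n; m+n≤o⇒n≤o; m+n≤o⇒m≤o∸n; m≤n+o⇒m∸n≤o; m∸n+n≡m
        ; module ≤-Reasoning)
open import Data.Product using (∃; _×_; _,_; proj₁; proj₂)
open import Data.Sum using (_⊎_; inj₁; inj₂; [_,_]; [_,_]′)
open import Data.Unit using (⊤; tt)
open import Function using (id)
open import Function.Bundles using (_⇔_; mk⇔; Equivalence)
import Function.Properties.Equivalence as ⇔
open import Level using (0ℓ)
open import Relation.Binary using (Rel; Symmetric; tri<; tri≈; tri>)
open import Relation.Binary.PropositionalEquality
  using (_≡_; _≢_; refl; sym; trans; cong; cong₂; subst; module ≡-Reasoning)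
open import Relation.Nullary using (¬_; Dec; yes; no)
open import Relation.Nullary.Decidable using (_×-dec_; _⊎-dec_; ¬?; map′; decidable-stable)
open import Relation.Unary using (Pred; Decidable; _⊆_; _≐_; _∪_; _∩_; _∖_; ∁; Empty; Universal)
open import Relation.Unary.Properties using (_∪?_; _∩?_; ∁?)

open import Defs

length-unique : ∀ {A : Set} {xs ys : List A} → Unique xs → Unique ys →
                (∀ {x} → x ∈ xs ⇔ x ∈ ys) → length xs ≡ length ys
length-unique xs-unique ys-unique same = ↭-length (∼bag⇒↭ (unique∧set⇒bag xs-unique ys-unique same))

module Counting {A : Set} (universe : List A) (universe-unique : Unique universe)
                (universe-complete : ∀ x → x ∈ universe) where

  opaque
    select : {P : Pred A 0ℓ} → Decidable P → List A
    select P? = filter P? universe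

    select-unique : ∀ {P : Pred A 0ℓ} (P? : Decidable P) → Unique (select P?)
    select-unique P? = filter⁺ P? universe-unique

    ∈-select⁺ : ∀ {P : Pred A 0ℓ} (P? : Decidable P) {x} → P x → x ∈ select P?
    ∈-select⁺ P? {x} = ∈-filter⁺ P? (universe-complete x)

    ∈-select⁻ : ∀ {P : Pred A 0ℓ} (P? : Decidable P) {x} → x ∈ select P? → P x
    ∈-select⁻ P? x∈ = proj₂ (∈-filter⁻ P? {xs = universe} x∈)

  count : {P : Pred A 0ℓ} → Decidable P → ℕ
  count P? = length (select P?)

  module _ {P : Pred A 0ℓ} (P? : Decidable P) where

    count-≡-length : ∀ {L} → Unique L → (∀ {x} → x ∈ L ⇔ P x) → count P? ≡ length L
    count-≡-length L-unique L⇔P = length-unique (select-unique P?) L-unique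
      (mk⇔ (λ x∈ → Equivalence.from L⇔P (∈-select⁻ P? x∈)) (λ x∈ → ∈-select⁺ P? (Equivalence.to L⇔P x∈)))

    count-image : ∀ {C : Set} {f : C → A} → (∀ {c c′} → f c ≡ f c′ → c ≡ c′) → ∀ {L} → Unique L →
                  (∀ {a} → P a ⇔ ∃ λ c → c ∈ L × a ≡ f c) → count P? ≡ length L
    count-image {f = f} f-injective {L} L-unique P⇔image =
      trans (count-≡-length (map⁺ f-injective L-unique) (mk⇔ to from)) (length-map f L)
      where
      to : ∀ {a} → a ∈ List.map f L → P a
      to a∈ = Equivalence.from P⇔image (∈-map⁻ f a∈)
      from : ∀ {a} → P a → a ∈ List.map f L
      from Pa with Equivalence.to P⇔image Pa
      ... | _ , c∈L , refl = ∈-map⁺ f c∈L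

    count-empty : Empty P → count P? ≡ 0
    count-empty ¬P = count-≡-length [] (mk⇔ (λ ()) (λ Px → ⊥-elim (¬P _ Px)))

    count-singleton : ∀ {a} → P a → (∀ {x} → P x → x ≡ a) → count P? ≡ 1
    count-singleton Pa only-a = count-≡-length (All.[] ∷ [])
      (mk⇔ (λ { (here refl) → Pa }) (λ Px → here (only-a Px)))

    count-subsingleton : (∀ {x y} → P x → P y → x ≡ y) → count P? ≤ 1
    count-subsingleton unique with select P? | select-unique P? | ∈-select⁻ P?
    ... | []        | _                  | _  = z≤n
    ... | _ ∷ []    | _                  | _  = s≤s z≤n
    ... | _ ∷ _ ∷ _ | (x≢y All.∷ _) ∷ _ | Ps = ⊥-elim (x≢y (unique (Ps (here refl)) (Ps (there (here refl)))))

    count-pos : ∀ {a} → P a → 0 < count P?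
    count-pos Pa with select P? | ∈-select⁺ P? Pa
    ... | _ ∷ _ | _ = s≤s z≤n

  module _ {P Q : Pred A 0ℓ} (P? : Decidable P) (Q? : Decidable Q) where

    count-cong : P ≐ Q → count P? ≡ count Q?
    count-cong (P⊆Q , Q⊆P) = count-≡-length P? (select-unique Q?)
      (mk⇔ (λ x∈ → Q⊆P (∈-select⁻ Q? x∈)) (λ Px → ∈-select⁺ Q? (P⊆Q Px)))

    count-∪ : Empty (P ∩ Q) → count (P? ∪? Q?) ≡ count P? + count Q?
    count-∪ disjoint = trans (count-≡-length (P? ∪? Q?) unique (mk⇔ to from)) (length-++ (select P?))
      where
      unique : Unique (select P? List.++ select Q?)
      unique = ++⁺ (select-unique P?) (select-unique Q?)
                   (λ (x∈P , x∈Q) → disjoint _ (∈-select⁻ P? x∈P , ∈-select⁻ Q? x∈Q))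
      to : ∀ {x} → x ∈ select P? List.++ select Q? → (P ∪ Q) x
      to x∈ with ∈-++⁻ (select P?) x∈
      ... | inj₁ x∈P = inj₁ (∈-select⁻ P? x∈P)
      ... | inj₂ x∈Q = inj₂ (∈-select⁻ Q? x∈Q)
      from : ∀ {x} → (P ∪ Q) x → x ∈ select P? List.++ select Q?
      from (inj₁ Px) = ∈-++⁺ˡ (∈-select⁺ P? Px)
      from (inj₂ Qx) = ∈-++⁺ʳ (select P?) (∈-select⁺ Q? Qx)

  module _ {P Q : Pred A 0ℓ} (P? : Decidable P) (Q? : Decidable Q) where

    count-∖ : P ⊆ Q → count Q? ≡ count P? + count (Q? ∩? ∁? P?)
    count-∖ P⊆Q = trans (count-cong Q? (P? ∪? (Q? ∩? ∁? P?)) (split , join))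
                        (count-∪ P? (Q? ∩? ∁? P?) λ _ (Px , _ , ¬Px) → ¬Px Px)
      where
      split : Q ⊆ P ∪ (Q ∖ P)
      split {x} Qx with P? x
      ... | yes Px = inj₁ Px
      ... | no ¬Px = inj₂ (Qx , ¬Px)
      join : P ∪ (Q ∖ P) ⊆ Q
      join (inj₁ Px)       = P⊆Q Px
      join (inj₂ (Qx , _)) = Qx

    count-mono : P ⊆ Q → count P? ≤ count Q?
    count-mono P⊆Q = ≤-trans (m≤m+n (count P?) _) (≤-reflexive (sym (count-∖ P⊆Q)))

    count-strict : P ⊆ Q → ∀ {a} → Q a → ¬ P a → count P? < count Q?
    count-strict P⊆Q Qa ¬Pa = begin-strict
      count P?                        ≡⟨ +-identityʳ _ ⟨
      count P? + 0                    <⟨ +-monoʳ-< (count P?) (count-pos (Q? ∩? ∁? P?) (Qa , ¬Pa)) ⟩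
      count P? + count (Q? ∩? ∁? P?)  ≡⟨ count-∖ P⊆Q ⟨
      count Q?                        ∎
      where open ≤-Reasoning

  module _ {P Q : Pred A 0ℓ} (P? : Decidable P) (Q? : Decidable Q) where

    count-∪-≤ : count (P? ∪? Q?) ≤ count P? + count Q?
    count-∪-≤ = begin
      count (P? ∪? Q?)                        ≡⟨ count-∖ P? (P? ∪? Q?) inj₁ ⟩
      count P? + count ((P? ∪? Q?) ∩? ∁? P?)  ≤⟨ +-monoʳ-≤ (count P?) (count-mono _ Q? in-Q) ⟩
      count P? + count Q?                     ∎
      where
      open ≤-Reasoning
      in-Q : (P ∪ Q) ∖ P ⊆ Q
      in-Q (inj₁ Px , ¬Px) = ⊥-elim (¬Px Px)
      in-Q (inj₂ Qx , _)   = Qx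

module Walks {n : ℕ} (E : Rel (Fin n) 0ℓ) where

  data WalkIn (P : Pred (Fin n) 0ℓ) : Fin n → Fin n → ℕ → Set where
    nil  : ∀ {x} → P x → WalkIn P x x 0
    cons : ∀ {x w y k} → P x → E x w → WalkIn P w y k → WalkIn P x y (suc k)

  private variable
    P Q : Pred (Fin n) 0ℓ
    x y z : Fin n
    i j k ℓ : ℕ

  start-in : WalkIn P x y k → P x
  start-in (nil Px)      = Px
  start-in (cons Px _ _) = Px

  end-in : WalkIn P x y k → P y
  end-in (nil Py)     = Py
  end-in (cons _ _ p) = end-in p

  _++_ : WalkIn P x y k → WalkIn P y z ℓ → WalkIn P x z (k + ℓ)
  nil _       ++ q = q
  cons Px e p ++ q = cons Px e (p ++ q)

  map : P ⊆ Q → WalkIn P x y k → WalkIn Q x y k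
  map P⊆Q (nil Px)      = nil (P⊆Q Px)
  map P⊆Q (cons Px e p) = cons (P⊆Q Px) e (map P⊆Q p)

  reverse : Symmetric E → WalkIn P x y k → WalkIn P y x k
  reverse E-sym (nil Px) = nil Px
  reverse {k = suc k} E-sym (cons Px e p) =
    subst (WalkIn _ _ _) (+-comm k 1) (reverse E-sym p ++ cons (start-in p) (E-sym e) (nil Px))

  avoiding : ∀ z → (∀ {a} → ¬ WalkIn P x z a) → WalkIn P x y k → WalkIn (λ v → P v × v ≢ z) x y k
  avoiding z unreachable (nil Px)      = nil (Px , λ { refl → unreachable (nil Px) })
  avoiding z unreachable (cons Px e p) =
    cons (Px , λ { refl → unreachable (nil Px) }) e (avoiding z (λ q → unreachable (cons Px e q)) p)

  -- Past the end of the walk, vertex p i stays at the last vertex.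
  vertex : WalkIn P x y k → ℕ → Fin n
  vertex {x = x} _            zero    = x
  vertex {x = x} (nil _)      (suc i) = x
  vertex         (cons _ _ p) (suc i) = vertex p i

  take : ∀ i → i ≤ k → (p : WalkIn P x y k) → WalkIn P x (vertex p i) i
  take zero    _         p             = nil (start-in p)
  take (suc i) (s≤s i≤k) (cons Px e p) = cons Px e (take i i≤k p)

  drop : ∀ i → i ≤ k → (p : WalkIn P x y k) → WalkIn P (vertex p i) y (k ∸ i)
  drop zero    _         p            = p
  drop (suc i) (s≤s i≤k) (cons _ _ p) = drop i i≤k p

  vertex-in : (p : WalkIn P x y k) → i ≤ k → P (vertex p i)
  vertex-in p i≤k = end-in (take _ i≤k p)

  vertex-end : (p : WalkIn P x y k) → vertex p k ≡ y
  vertex-end (nil _)                   = refl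
  vertex-end (cons _ _ (nil _))        = refl
  vertex-end (cons _ _ p@(cons _ _ _)) = vertex-end p

  vertex-step : (p : WalkIn P x y k) → i < k → E (vertex p i) (vertex p (suc i))
  vertex-step {i = zero}  (cons _ e _) _         = e
  vertex-step {i = suc i} (cons _ _ p) (s≤s i<k) = vertex-step p i<k

  private
    +∸-< : i < j → j ≤ k → i + (k ∸ j) < k
    +∸-< {j = j} {k = k} i<j j≤k = <-≤-trans (+-monoˡ-< (k ∸ j) i<j) (≤-reflexive (m+[n∸m]≡n j≤k))

  shortcut : (p : WalkIn P x y k) → i < j → j ≤ k → vertex p i ≡ vertex p j →
             ∃ λ ℓ → ℓ < k × WalkIn P x y ℓ
  shortcut p i<j j≤k pᵢ≡pⱼ = _ , +∸-< i<j j≤k ,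
    (take _ (≤-trans (<⇒≤ i<j) j≤k) p ++ subst (λ v → WalkIn _ v _ _) (sym pᵢ≡pⱼ) (drop _ j≤k p))

  chord-shortcut : (p : WalkIn P x y k) → suc i < j → j ≤ k → E (vertex p i) (vertex p j) →
                   ∃ λ ℓ → ℓ < k × WalkIn P x y ℓ
  chord-shortcut {k = k} {i = i} {j = j} p 1+i<j j≤k chord = _ ,
    ≤-trans (≤-reflexive (cong suc (+-suc i (k ∸ j)))) (+∸-< 1+i<j j≤k) ,
    (take i i≤k p ++ cons (vertex-in p i≤k) chord (drop j j≤k p))
    where
    i≤k : i ≤ k
    i≤k = ≤-trans (n≤1+n i) (≤-trans (<⇒≤ 1+i<j) j≤k)

  Shortest : Pred (Fin n) 0ℓ → Fin n → Fin n → ℕ → Set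
  Shortest P x y ℓ = ∀ {j} → j < ℓ → ¬ WalkIn P x y j

  module _ {p : WalkIn P x y ℓ} (minimal : Shortest P x y ℓ) where

    shortest-injective : i < j → j ≤ ℓ → vertex p i ≢ vertex p j
    shortest-injective i<j j≤ℓ pᵢ≡pⱼ with shortcut p i<j j≤ℓ pᵢ≡pⱼ
    ... | _ , shorter , q = minimal shorter q

    shortest-induced : suc i < j → j ≤ ℓ → ¬ E (vertex p i) (vertex p j)
    shortest-induced 1+i<j j≤ℓ chord with chord-shortcut p 1+i<j j≤ℓ chord
    ... | _ , shorter , q = minimal shorter q

    shortest-bounded : ℓ < n
    shortest-bounded with ℓ ℕ.<? n
    ... | yes ℓ<n = ℓ<n
    ... | no ℓ≮n with pigeonhole (s≤s (≮⇒≥ ℓ≮n)) (λ (i : Fin (suc ℓ)) → vertex p (toℕ i))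
    ...   | i , j , i<j , pᵢ≡pⱼ = ⊥-elim (shortest-injective (toℕ-mono-< i<j) (toℕ≤pred[n] j) pᵢ≡pⱼ)

  Reachable : Pred (Fin n) 0ℓ → Fin n → Fin n → Set
  Reachable P x y = ∃ λ k → WalkIn P x y k

  LongWalk : Pred (Fin n) 0ℓ → Fin n → Fin n → Set
  LongWalk P x y = ∃ λ k → WalkIn P x y (suc (suc k))

  module _ (P? : Decidable P) (E? : ∀ u v → Dec (E u v)) where

    walk? : ∀ k x y → Dec (WalkIn P x y k)
    walk? zero x y with x ≟ y | P? x
    ... | yes refl | yes Px = yes (nil Px)
    ... | yes refl | no ¬Px = no λ p → ¬Px (start-in p)
    ... | no x≢y   | _      = no λ { (nil _) → x≢y refl }
    walk? (suc k) x y with P? x | any? (λ w → E? x w ×-dec walk? k w y)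
    ... | no ¬Px | _               = no λ p → ¬Px (start-in p)
    ... | yes Px | yes (_ , e , p) = yes (cons Px e p)
    ... | yes Px | no none         = no λ { (cons _ e p) → none (_ , e , p) }

    shortest : WalkIn P x y k → ∃ λ ℓ → WalkIn P x y ℓ × Shortest P x y ℓ
    shortest {x = x} {y = y} = <-rec Goal go _
      where
      Goal : ℕ → Set
      Goal k = WalkIn P x y k → ∃ λ ℓ → WalkIn P x y ℓ × Shortest P x y ℓ
      go : ∀ k → (∀ {j} → j < k → Goal j) → Goal k
      go k rec p with any? (λ (j : Fin k) → walk? (toℕ j) x y)
      ... | yes (j , q) = rec (toℕ<n j) q
      ... | no none     = k , p , λ j<k q →
        none (fromℕ< j<k , subst (WalkIn P x y) (sym (toℕ-fromℕ< j<k)) q)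

    reachable? : ∀ x y → Dec (Reachable P x y)
    reachable? x y = map′
      (λ (k , p) → toℕ k , p)
      (λ (_ , p) → let ℓ , q , minimal = shortest p
                   in fromℕ< (shortest-bounded {p = q} minimal) , subst (WalkIn P x y) (sym (toℕ-fromℕ< _)) q)
      (any? λ (k : Fin n) → walk? (toℕ k) x y)

    longWalk? : ∀ x y → Dec (LongWalk P x y)
    longWalk? x y = map′
      (λ (Px , _ , e , Pw , _ , e′ , k , q) → k , cons Px e (cons Pw e′ q))
      (λ { (k , cons Px e (cons Pw e′ q)) → Px , _ , e , Pw , _ , e′ , k , q })
      (P? x ×-dec any? λ w → E? x w ×-dec (P? w ×-dec any? λ z → E? w z ×-dec reachable? z y))

module GraphFacts (G : Graph) where
  open Graph G using (n; adj; loopless) renaming (sym to adj-sym)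
  open Walks (Adj G)

  module V = Counting (allFin n) (allFin⁺ n) ∈-allFin
  module Arcs = Counting (cartesianProduct (allFin n) (allFin n))
                         (cartesianProduct⁺ (allFin⁺ n) (allFin⁺ n))
                         (λ (u , v) → ∈-cartesianProduct⁺ (∈-allFin u) (∈-allFin v))

  Adj? : ∀ u v → Dec (Adj G u v)
  Adj? u v = adj u v Bool.≟ true

  Adj-sym : Symmetric (Adj G)
  Adj-sym {u} {v} uv = trans (adj-sym v u) uv

  Adj-irrefl : ∀ {u v} → Adj G u v → u ≢ v
  Adj-irrefl {u} uu refl with trans (sym uu) (loopless u)
  ... | ()

  IsClique : Pred (Fin n) 0ℓ → Set
  IsClique K = ∀ {x y} → K x → K y → x ≢ y → Adj G x y

  IsSimplicial : Pred (Fin n) 0ℓ → Fin n → Set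
  IsSimplicial W s = ∀ {x y} → W x → W y → Adj G s x → Adj G s y → x ≢ y → Adj G x y

  module ClosingCycle {Q : Pred (Fin n) 0ℓ} {v x y : Fin n} {ℓ : ℕ} (p : WalkIn Q x y ℓ)
                      (minimal : Shortest Q x y ℓ) (vx : Adj G v x) (vy : Adj G v y)
                      (interior : ∀ {z} → Q z → z ≢ x → z ≢ y → z ≢ v × ¬ Adj G v z) where

    vert : Fin (suc (suc ℓ)) → Fin n
    vert zero    = v
    vert (suc i) = vertex p (toℕ i)

    on-path : ∀ (i : Fin (suc ℓ)) → toℕ i ≤ ℓ
    on-path = toℕ≤pred[n]

    path-injective : ∀ {a b} → a ≤ ℓ → b ≤ ℓ → vertex p a ≡ vertex p b → a ≡ b
    path-injective {a} {b} a≤ℓ b≤ℓ pₐ≡p_b with <-cmp a b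
    ... | tri< a<b _ _ = ⊥-elim (shortest-injective minimal a<b b≤ℓ pₐ≡p_b)
    ... | tri≈ _ a≡b _ = a≡b
    ... | tri> _ _ b<a = ⊥-elim (shortest-injective minimal b<a a≤ℓ (sym pₐ≡p_b))

    off-path : ∀ {a} → a ≤ ℓ → a ≢ 0 → a ≢ ℓ → vertex p a ≢ v × ¬ Adj G v (vertex p a)
    off-path a≤ℓ a≢0 a≢ℓ = interior (vertex-in p a≤ℓ)
      (λ pₐ≡x → a≢0 (path-injective a≤ℓ z≤n pₐ≡x))
      (λ pₐ≡y → a≢ℓ (path-injective a≤ℓ ≤-refl (trans pₐ≡y (sym (vertex-end p)))))

    path-avoids-v : ∀ {a} → a ≤ ℓ → vertex p a ≢ v
    path-avoids-v {a} a≤ℓ pₐ≡v with a ℕ.≟ 0 | a ℕ.≟ ℓ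
    ... | yes refl | _        = Adj-irrefl vx (sym pₐ≡v)
    ... | no _     | yes refl = Adj-irrefl vy (sym (trans (sym (vertex-end p)) pₐ≡v))
    ... | no a≢0   | no a≢ℓ   = proj₁ (off-path a≤ℓ a≢0 a≢ℓ) pₐ≡v

    vert-injective : ∀ {a b} → vert a ≡ vert b → a ≡ b
    vert-injective {zero}  {zero}  _  = refl
    vert-injective {zero}  {suc b} eq = ⊥-elim (path-avoids-v (on-path b) (sym eq))
    vert-injective {suc a} {zero}  eq = ⊥-elim (path-avoids-v (on-path a) eq)
    vert-injective {suc a} {suc b} eq = cong suc (toℕ-injective (path-injective (on-path a) (on-path b) eq))

    vert-next : ∀ a b → suc (toℕ a) ≡ toℕ b → Adj G (vert a) (vert b)
    vert-next zero    (suc b) eq = subst (λ i → Adj G v (vertex p i)) (suc-injective eq) vx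
    vert-next (suc a) (suc b) eq = subst (λ i → Adj G (vertex p (toℕ a)) (vertex p i)) (suc-injective eq)
      (vertex-step p (≤-trans (≤-reflexive (suc-injective eq)) (on-path b)))

    vert-wrap : ∀ a b → toℕ a ≡ 0 → suc (toℕ b) ≡ 2 + ℓ → Adj G (vert b) (vert a)
    vert-wrap zero zero    _ ()
    vert-wrap zero (suc b) _ eq = subst (λ z → Adj G z v)
      (sym (trans (cong (vertex p) (suc-injective (suc-injective eq))) (vertex-end p))) (Adj-sym vy)

    cycle : Cycle G (suc (suc ℓ))
    cycle = record { vert = vert ; inj = vert-injective ; next = vert-next ; wrap = vert-wrap }

    chordless : ¬ HasChord G cycle
    chordless (zero , suc b , _ , not-next , not-wrap , chord) =
      proj₂ (off-path (on-path b) (λ b≡0 → not-next (cong suc (sym b≡0)))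
                                  (λ b≡ℓ → not-wrap (refl , cong (λ i → suc (suc i)) b≡ℓ))) chord
    chordless (suc a , suc b , s≤s a<b , not-next , _ , chord) =
      shortest-induced minimal (≤∧≢⇒< a<b (λ a≡b → not-next (cong suc a≡b))) (on-path b) chord

  shortest-path-closes : Chordal G → ∀ {Q v x y ℓ} (p : WalkIn Q x y ℓ) → Shortest Q x y ℓ → x ≢ y →
                         Adj G v x → Adj G v y → (∀ {z} → Q z → z ≢ x → z ≢ y → z ≢ v × ¬ Adj G v z) →
                         Adj G x y
  shortest-path-closes _ (nil _) _ x≢y _ _ _ = ⊥-elim (x≢y refl)
  shortest-path-closes _ (cons _ xy (nil _)) _ _ _ _ _ = xy
  shortest-path-closes chordal {ℓ = suc (suc _)} p minimal _ vx vy interior =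
    ⊥-elim (chordless (chordal _ (s≤s (s≤s (s≤s (s≤s z≤n)))) cycle))
    where open ClosingCycle p minimal vx vy interior

module ChordalGraphs (G : Graph) (chordal : Chordal G) where
  open Graph G using (n)
  open GraphFacts G
  open Walks (Adj G)

  SimplicialOutside : (W K : Pred (Fin n) 0ℓ) → Set
  SimplicialOutside W K = ∃ λ s → W s × ¬ K s × IsSimplicial W s

  SimplicialOutsideCliques : ∀ {W} → Decidable W → Set₁
  SimplicialOutsideCliques {W} W? =
    ∀ {K} → Decidable K → K ⊆ W → IsClique K → ∀ {w} → W w → ¬ K w → SimplicialOutside W K

  module _ {W : Pred (Fin n) 0ℓ} (W? : Decidable W)
           (IH : ∀ {W′} (W′? : Decidable W′) → V.count W′? < V.count W? → SimplicialOutsideCliques W′?)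
           {K : Pred (Fin n) 0ℓ} (K? : Decidable K) (K⊆W : K ⊆ W) (clique : IsClique K)
           {v : Fin n} (Wv : W v) (K⊆N[v] : ∀ {z} → K z → z ≡ v ⊎ Adj G v z) where

    -- The component R of c₀ in W minus the closed neighbourhood of v is separated from v by its
    -- neighbourhood S, a clique by chordality; a simplicial vertex of R ∪ S outside S lies in R and
    -- is simplicial in W.
    module Separator {c₀ : Fin n} (Wc₀ : W c₀) (c₀≢v : c₀ ≢ v) (¬vc₀ : ¬ Adj G v c₀) where

      U : Pred (Fin n) 0ℓ
      U c = W c × c ≢ v × ¬ Adj G v c

      U? : Decidable U
      U? c = W? c ×-dec (¬? (c ≟ v) ×-dec ¬? (Adj? v c))

      R : Pred (Fin n) 0ℓ
      R x = Reachable U x c₀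

      R? : Decidable R
      R? x = reachable? U? Adj? x c₀

      R⊆U : R ⊆ U
      R⊆U (_ , p) = start-in p

      R-closed : ∀ {x y} → R x → U y → Adj G y x → R y
      R-closed (k , p) Uy yx = suc k , cons Uy yx p

      walk-in-R : ∀ {x k} → WalkIn U x c₀ k → WalkIn R x c₀ k
      walk-in-R p@(nil _)      = nil (_ , p)
      walk-in-R p@(cons _ e q) = cons (_ , p) e (walk-in-R q)

      Rc₀ : R c₀
      Rc₀ = 0 , nil (Wc₀ , c₀≢v , ¬vc₀)

      NearR : Pred (Fin n) 0ℓ
      NearR x = ∃ λ c → R c × Adj G c x

      NearR? : Decidable NearR
      NearR? x = any? λ c → R? c ×-dec Adj? c x

      W₁ S : Pred (Fin n) 0ℓ
      W₁ x = R x ⊎ (W x × NearR x)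
      S  x = W x × ¬ R x × NearR x

      W₁? : Decidable W₁
      W₁? x = R? x ⊎-dec (W? x ×-dec NearR? x)

      S? : Decidable S
      S? x = W? x ×-dec (¬? (R? x) ×-dec NearR? x)

      W₁⊆W : W₁ ⊆ W
      W₁⊆W (inj₁ Rx)       = proj₁ (R⊆U Rx)
      W₁⊆W (inj₂ (Wx , _)) = Wx

      S⊆W₁ : S ⊆ W₁
      S⊆W₁ (Wx , _ , near) = inj₂ (Wx , near)

      v∉W₁ : ¬ W₁ v
      v∉W₁ (inj₁ Rv)                = proj₁ (proj₂ (R⊆U Rv)) refl
      v∉W₁ (inj₂ (_ , c , Rc , cv)) = proj₂ (proj₂ (R⊆U Rc)) (Adj-sym cv)

      S⊆N[v] : ∀ {x} → S x → Adj G v x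
      S⊆N[v] {x} (Wx , ¬Rx , c , Rc , cx) = decidable-stable (Adj? v x) λ ¬vx →
        ¬Rx (R-closed Rc (Wx , (λ { refl → proj₂ (proj₂ (R⊆U Rc)) (Adj-sym cx) }) , ¬vx) (Adj-sym cx))

      S-clique : IsClique S
      S-clique {x} {y} Sx@(_ , _ , _ , (_ , cx⇝c₀) , cx~x) Sy@(_ , _ , _ , (_ , cy⇝c₀) , cy~y) x≢y =
        shortest-path-closes chordal path minimal x≢y (S⊆N[v] Sx) (S⊆N[v] Sy) interior
        where
        Q : Pred (Fin n) 0ℓ
        Q z = R z ⊎ (z ≡ x ⊎ z ≡ y)
        Q? : Decidable Q
        Q? z = R? z ⊎-dec ((z ≟ x) ⊎-dec (z ≟ y))
        x⇝y : WalkIn Q x y _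
        x⇝y = cons (inj₂ (inj₁ refl)) (Adj-sym cx~x) (map inj₁ (walk-in-R cx⇝c₀)
              ++ reverse Adj-sym (cons (inj₂ (inj₂ refl)) (Adj-sym cy~y) (map inj₁ (walk-in-R cy⇝c₀))))
        shortest-x⇝y : ∃ λ ℓ → WalkIn Q x y ℓ × Shortest Q x y ℓ
        shortest-x⇝y = shortest Q? Adj? x⇝y
        path : WalkIn Q x y (proj₁ shortest-x⇝y)
        path = proj₁ (proj₂ shortest-x⇝y)
        minimal : Shortest Q x y (proj₁ shortest-x⇝y)
        minimal = proj₂ (proj₂ shortest-x⇝y)
        interior : ∀ {z} → Q z → z ≢ x → z ≢ y → z ≢ v × ¬ Adj G v z
        interior (inj₁ Rz)         _   _   = proj₂ (R⊆U Rz)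
        interior (inj₂ (inj₁ z≡x)) z≢x _   = ⊥-elim (z≢x z≡x)
        interior (inj₂ (inj₂ z≡y)) _   z≢y = ⊥-elim (z≢y z≡y)

      W₁∖S⊆R : ∀ {x} → W₁ x → ¬ S x → R x
      W₁∖S⊆R (inj₁ Rx)               _   = Rx
      W₁∖S⊆R {x} (inj₂ (Wx , near)) ¬Sx = decidable-stable (R? x) λ ¬Rx → ¬Sx (Wx , ¬Rx , near)

      R∩K-empty : ∀ {x} → R x → ¬ K x
      R∩K-empty Rx Kx = [ proj₁ (proj₂ (R⊆U Rx)) , proj₂ (proj₂ (R⊆U Rx)) ] (K⊆N[v] Kx)

      lift : SimplicialOutside W₁ S → SimplicialOutside W K
      lift (s , W₁s , ¬Ss , simplicial) = s , W₁⊆W W₁s , R∩K-empty Rs ,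
        λ Wx Wy sx sy → simplicial (inj₂ (Wx , s , Rs , sx)) (inj₂ (Wy , s , Rs , sy)) sx sy
        where
        Rs : R s
        Rs = W₁∖S⊆R W₁s ¬Ss

      separator-case : SimplicialOutside W K
      separator-case = lift (IH W₁? (V.count-strict W₁? W? W₁⊆W Wv v∉W₁) S? S⊆W₁ S-clique (inj₁ Rc₀)
                                λ (_ , ¬Rc₀ , _) → ¬Rc₀ Rc₀)

    module Dominating (dominates : ∀ {c} → W c → c ≢ v → Adj G v c) where

      W∖v? : Decidable (λ z → W z × z ≢ v)
      W∖v? z = W? z ×-dec ¬? (z ≟ v)

      K∖v? : Decidable (λ z → K z × z ≢ v)
      K∖v? z = K? z ×-dec ¬? (z ≟ v)

      lift : SimplicialOutside (λ z → W z × z ≢ v) (λ z → K z × z ≢ v) → SimplicialOutside W K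
      lift (s , (Ws , s≢v) , ¬K∖v-s , simplicial) = s , Ws , (λ Ks → ¬K∖v-s (Ks , s≢v)) , simplicial′
        where
        simplicial′ : IsSimplicial W s
        simplicial′ {x} {y} Wx Wy sx sy x≢y with x ≟ v | y ≟ v
        ... | yes refl | _        = dominates Wy (λ y≡x → x≢y (sym y≡x))
        ... | no _     | yes refl = Adj-sym (dominates Wx x≢y)
        ... | no x≢v   | no y≢v   = simplicial (Wx , x≢v) (Wy , y≢v) sx sy x≢y

      dominating-case : ∀ {w} → W w → ¬ K w → SimplicialOutside W K
      dominating-case {w} Ww ¬Kw with any? (λ x → W? x ×-dec (¬? (K? x) ×-dec ¬? (x ≟ v)))
      ... | yes (_ , Wx , ¬Kx , x≢v) =
        lift (IH W∖v? (V.count-strict W∖v? W? proj₁ Wv λ (_ , v≢v) → v≢v refl) K∖v?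
                 (λ (Kz , z≢v) → K⊆W Kz , z≢v) (λ Ka Kb → clique (proj₁ Ka) (proj₁ Kb))
                 (Wx , x≢v) (λ (Kx , _) → ¬Kx Kx))
      ... | no only-v = v , Wv , ¬Kv , λ Wx Wy vx vy → clique (in-K Wx vx) (in-K Wy vy)
        where
        ¬Kv : ¬ K v
        ¬Kv Kv with w ≟ v
        ... | yes refl = ¬Kw Kv
        ... | no w≢v   = only-v (w , Ww , ¬Kw , w≢v)
        in-K : ∀ {x} → W x → Adj G v x → K x
        in-K {x} Wx vx = decidable-stable (K? x) λ ¬Kx → only-v (x , Wx , ¬Kx , λ x≡v → Adj-irrefl vx (sym x≡v))

    simplicial-outside-near : ∀ {w} → W w → ¬ K w → SimplicialOutside W K
    simplicial-outside-near with any? (λ c → W? c ×-dec (¬? (c ≟ v) ×-dec ¬? (Adj? v c)))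
    ... | yes (_ , Wc₀ , c₀≢v , ¬vc₀) = λ _ _ → Separator.separator-case Wc₀ c₀≢v ¬vc₀
    ... | no dominating = Dominating.dominating-case
      λ {c} Wc c≢v → decidable-stable (Adj? v c) λ ¬vc → dominating (c , Wc , c≢v , ¬vc)

  simplicial-outside-clique : ∀ {W} (W? : Decidable W) → SimplicialOutsideCliques W?
  simplicial-outside-clique W? = <-rec Goal induction-step _ W? refl
    where
    Goal : ℕ → Set₁
    Goal m = ∀ {W} (W? : Decidable W) → V.count W? ≡ m → SimplicialOutsideCliques W?
    induction-step : ∀ m → (∀ {m′} → m′ < m → Goal m′) → Goal m
    induction-step _ rec {W} W? refl {K} K? K⊆W clique Ww ¬Kw with any? K?
    ... | yes (k , Kk) = simplicial-outside-near W? IH K? K⊆W clique (K⊆W Kk) K⊆N[k] Ww ¬Kw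
      where
      IH : ∀ {W′} (W′? : Decidable W′) → V.count W′? < V.count W? → SimplicialOutsideCliques W′?
      IH W′? smaller = rec smaller W′? refl
      K⊆N[k] : ∀ {z} → K z → z ≡ k ⊎ Adj G k z
      K⊆N[k] {z} Kz with z ≟ k
      ... | yes z≡k = inj₁ z≡k
      ... | no z≢k  = inj₂ (clique Kk Kz (λ k≡z → z≢k (sym k≡z)))
    ... | no K-empty = simplicial-outside-near W? (λ W′? smaller → rec smaller W′? refl) K? K⊆W clique
                         Ww (λ Kz → ⊥-elim (K-empty (_ , Kz))) Ww ¬Kw

  simplicial-vertex : ∀ {W} → Decidable W → ∀ {w} → W w → ∃ λ s → W s × IsSimplicial W s
  simplicial-vertex W? Ww with simplicial-outside-clique W? {K = λ _ → ⊥} (λ _ → no λ ()) (λ ()) (λ ()) Ww (λ ())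
  ... | s , Ws , _ , simplicial = s , Ws , simplicial

  data PerfectEliminationOrdering : List (Fin n) → Set where
    []  : PerfectEliminationOrdering []
    _∷_ : ∀ {s σ} → s ∉ σ × IsSimplicial (_∈ σ) s → PerfectEliminationOrdering σ →
          PerfectEliminationOrdering (s ∷ σ)

  OrderingOf : Pred (Fin n) 0ℓ → Set
  OrderingOf W = ∃ λ σ → PerfectEliminationOrdering σ × (∀ {x} → x ∈ σ ⇔ W x)

  ordering-∷ : ∀ {W s} → W s → IsSimplicial W s → OrderingOf (λ x → W x × x ≢ s) → OrderingOf W
  ordering-∷ {W} {s} Ws simplicial (σ , peo , σ⇔W∖s) =
    s ∷ σ , (s∉σ , λ x∈σ y∈σ → simplicial (in-W x∈σ) (in-W y∈σ)) ∷ peo , mk⇔ to from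
    where
    in-W : ∀ {x} → x ∈ σ → W x
    in-W x∈σ = proj₁ (Equivalence.to σ⇔W∖s x∈σ)
    s∉σ : s ∉ σ
    s∉σ s∈σ = proj₂ (Equivalence.to σ⇔W∖s s∈σ) refl
    to : ∀ {x} → x ∈ s ∷ σ → W x
    to (here refl) = Ws
    to (there x∈σ) = in-W x∈σ
    from : ∀ {x} → W x → x ∈ s ∷ σ
    from {x} Wx with x ≟ s
    ... | yes refl = here refl
    ... | no x≢s   = there (Equivalence.from σ⇔W∖s (Wx , x≢s))

  ordering-of : ∀ {W} (W? : Decidable W) → OrderingOf W
  ordering-of W? = <-rec Goal induction-step _ W? refl
    where
    Goal : ℕ → Set₁
    Goal m = ∀ {W} (W? : Decidable W) → V.count W? ≡ m → OrderingOf W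
    induction-step : ∀ m → (∀ {m′} → m′ < m → Goal m′) → Goal m
    induction-step _ rec {W} W? refl with any? W?
    ... | no W-empty = [] , [] , mk⇔ (λ ()) (λ Wx → ⊥-elim (W-empty (_ , Wx)))
    ... | yes (_ , Ww) with simplicial-vertex W? Ww
    ...   | s , Ws , simplicial = ordering-∷ Ws simplicial (rec smaller W∖s? refl)
      where
      W∖s? : Decidable (λ x → W x × x ≢ s)
      W∖s? x = W? x ×-dec ¬? (x ≟ s)
      smaller : V.count W∖s? < V.count W?
      smaller = V.count-strict W∖s? W? proj₁ Ws λ (_ , s≢s) → s≢s refl

  perfect-elimination-ordering : ∃ λ σ → PerfectEliminationOrdering σ × ∀ x → x ∈ σ
  perfect-elimination-ordering with ordering-of {W = λ _ → ⊤} (λ _ → yes tt)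
  ... | σ , peo , σ⇔all = σ , peo , λ _ → Equivalence.from σ⇔all tt

module Orientations (G : Graph) where
  open Graph G using (n)
  open GraphFacts G
  open import Data.List.Membership.DecPropositional (_≟_ {n}) using (_∈?_)

  module _ (D : Orientation G) where

    Arc : Rel (Fin n) 0ℓ
    Arc u v = arc D u v ≡ true

    Arc? : ∀ u v → Dec (Arc u v)
    Arc? u v = arc D u v Bool.≟ true

    Arc⇒Adj : ∀ {u v} → Arc u v → Adj G u v
    Arc⇒Adj = arc⇒edge D _ _

    Arc-asym : ∀ {u v} → Arc u v → ¬ Arc v u
    Arc-asym {u} {v} uv vu with trans (sym uv) (trans (oneDir D u v (Arc⇒Adj uv)) (cong not vu))
    ... | ()

    Adj⇒Arc : ∀ {u v} → Adj G u v → Arc u v ⊎ Arc v u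
    Adj⇒Arc {u} {v} uv with arc D u v in eq | arc D v u in eq′
    ... | true  | _    = inj₁ refl
    ... | false | true = inj₂ refl
    ... | false | false with trans (sym eq) (trans (oneDir D u v uv) (cong not eq′))
    ...   | ()

    open Walks Arc

    toWalk : ∀ {P x y k} → WalkIn P x y k → Walk G D x y k
    toWalk (nil _)      = here
    toWalk (cons _ e p) = step e (toWalk p)

    fromWalk : ∀ {P x y k} → Universal P → Walk G D x y k → WalkIn P x y k
    fromWalk all here       = nil (all _)
    fromWalk all (step e p) = cons (all _) e (fromWalk all p)

    acyclic⇒no-closed-walk : Acyclic G D → ∀ {P x k} → ¬ WalkIn P x x (suc k)
    acyclic⇒no-closed-walk acyclic p = acyclic _ _ (toWalk p)

    DependentIn : List (Fin n) → Pred (Fin n × Fin n) 0ℓ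
    DependentIn X (u , v) = Arc u v × LongWalk (_∈ X) u v

    dependentIn? : ∀ X → Decidable (DependentIn X)
    dependentIn? X (u , v) = Arc? u v ×-dec longWalk? (_∈? X) Arc? u v

  dependents : List (Fin n) → Orientation G → ℕ
  dependents X D = Arcs.count (dependentIn? D X)

  module _ {σ : List (Fin n)} (σ-complete : ∀ x → x ∈ σ) (D : Orientation G) where

    dependentIn⇔Dependent : ∀ {p} → DependentIn D σ p ⇔ Dependent G D p
    dependentIn⇔Dependent = mk⇔ (λ (uv , k , p) → uv , k , toWalk D p)
                                (λ (uv , k , p) → uv , k , fromWalk D σ-complete p)

    NumDependent⇒≡dependents : ∀ {k} → NumDependent G D k → k ≡ dependents σ D
    NumDependent⇒≡dependents (L , L-unique , L⇔Dependent , refl) = sym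
      (Arcs.count-≡-length (dependentIn? D σ) L-unique (⇔.trans (L⇔Dependent _) (⇔.sym dependentIn⇔Dependent)))

    NumDependent-dependents : NumDependent G D (dependents σ D)
    NumDependent-dependents = Arcs.select (dependentIn? D σ) , Arcs.select-unique (dependentIn? D σ) ,
      (λ _ → ⇔.trans (mk⇔ (Arcs.∈-select⁻ (dependentIn? D σ)) (Arcs.∈-select⁺ (dependentIn? D σ)))
                     dependentIn⇔Dependent) ,
      refl

  module _ (D : Orientation G) (X : List (Fin n)) (s : Fin n) where

    DependentFrom DependentTo : Pred (Fin n × Fin n) 0ℓ
    DependentFrom (u , v) = u ≡ s × DependentIn D X (u , v)
    DependentTo   (u , v) = v ≡ s × DependentIn D X (u , v)

    dependentFrom? : Decidable DependentFrom
    dependentFrom? (u , v) = (u ≟ s) ×-dec dependentIn? D X (u , v)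

    dependentTo? : Decidable DependentTo
    dependentTo? (u , v) = (v ≟ s) ×-dec dependentIn? D X (u , v)

    count-dependentFrom : Arcs.count dependentFrom? ≡ V.count (λ v → dependentIn? D X (s , v))
    count-dependentFrom = Arcs.count-image dependentFrom? (cong proj₂) (V.select-unique _) (mk⇔
      (λ { (refl , dep) → _ , V.∈-select⁺ _ dep , refl })
      (λ { (_ , v∈ , refl) → refl , V.∈-select⁻ _ v∈ }))

    count-dependentTo : Arcs.count dependentTo? ≡ V.count (λ u → dependentIn? D X (u , s))
    count-dependentTo = Arcs.count-image dependentTo? (cong proj₁) (V.select-unique _) (mk⇔
      (λ { (refl , dep) → _ , V.∈-select⁺ _ dep , refl })
      (λ { (_ , u∈ , refl) → refl , V.∈-select⁻ _ u∈ }))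

  module _ {D : Orientation G} (acyclic : Acyclic G D) {K : Pred (Fin n) 0ℓ} (K? : Decidable K)
           (clique : IsClique K) where
    open Walks (Arc D)

    clique-transitive : ∀ {x y z} → K x → K z → Arc D x y → Arc D y z → Arc D x z
    clique-transitive {x} {y} {z} Kx Kz xy yz with x ≟ z
    ... | yes refl = ⊥-elim (acyclic⇒no-closed-walk D acyclic (cons tt xy (cons tt yz (nil tt))))
    ... | no x≢z   = [ id , (λ zx → ⊥-elim (acyclic⇒no-closed-walk D acyclic
                                 (cons tt xy (cons tt yz (cons tt zx (nil tt)))))) ]
                     (Adj⇒Arc D (clique Kx Kz x≢z))

    IsSourceAmong : List (Fin n) → Fin n → Set
    IsSourceAmong ys m = K m × ∀ {w} → w ∈ ys → K w → w ≢ m → Arc D m w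

    source-among : ∀ ys → (∀ {w} → w ∈ ys → ¬ K w) ⊎ ∃ (IsSourceAmong ys)
    source-among [] = inj₁ λ ()
    source-among (y ∷ ys) with K? y | source-among ys
    ... | no ¬Ky | inj₁ none          = inj₁ λ { (here refl) → ¬Ky ; (there w∈) → none w∈ }
    ... | no ¬Ky | inj₂ (m , Km , to) = inj₂ (m , Km , λ { (here refl) Ky → ⊥-elim (¬Ky Ky) ; (there w∈) → to w∈ })
    ... | yes Ky | inj₁ none          =
      inj₂ (y , Ky , λ { (here refl) _ y≢y → ⊥-elim (y≢y refl) ; (there w∈) Kw → ⊥-elim (none w∈ Kw) })
    ... | yes Ky | inj₂ (m , Km , to) with y ≟ m
    ...   | yes refl = inj₂ (m , Km , λ { (here refl) _ m≢m → ⊥-elim (m≢m refl) ; (there w∈) → to w∈ })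
    ...   | no y≢m with Adj⇒Arc D (clique Ky Km y≢m)
    ...     | inj₂ my = inj₂ (m , Km , λ { (here refl) _ _ → my ; (there w∈) → to w∈ })
    ...     | inj₁ ym = inj₂ (y , Ky , from-y)
      where
      from-y : ∀ {w} → w ∈ y ∷ ys → K w → w ≢ y → Arc D y w
      from-y (here refl) _ y≢y = ⊥-elim (y≢y refl)
      from-y {w} (there w∈) Kw w≢y with w ≟ m
      ... | yes refl = ym
      ... | no w≢m   = clique-transitive Ky Kw ym (to w∈ Kw w≢m)

    clique-source : Empty K ⊎ ∃ λ m → K m × ∀ {w} → K w → w ≢ m → Arc D m w
    clique-source with source-among (allFin n)
    ... | inj₁ none          = inj₁ λ w → none (∈-allFin w)
    ... | inj₂ (m , Km , to) = inj₂ (m , Km , λ Kw → to (∈-allFin _) Kw)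

module AddingSimplicialVertex (G : Graph) where
  open Graph G using (n; adj; loopless)
  open GraphFacts G
  open Orientations G
  open import Data.List.Membership.DecPropositional (_≟_ {n}) using (_∈?_)

  module _ {s : Fin n} {X′ : List (Fin n)} (s∉X′ : s ∉ X′) (simplicial : IsSimplicial (_∈ X′) s) where

    X : List (Fin n)
    X = s ∷ X′

    N : Pred (Fin n) 0ℓ
    N w = w ∈ X′ × Adj G s w

    N? : Decidable N
    N? w = (w ∈? X′) ×-dec Adj? s w

    degree : ℕ
    degree = V.count N?

    ∈X′ : ∀ {z} → z ∈ X → z ≢ s → z ∈ X′
    ∈X′ (here refl)  z≢s = ⊥-elim (z≢s refl)
    ∈X′ (there z∈X′) _   = z∈X′

    ∈X′⇒≢s : ∀ {z} → z ∈ X′ → z ≢ s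
    ∈X′⇒≢s z∈X′ refl = s∉X′ z∈X′

    N-clique : IsClique N
    N-clique (x∈X′ , sx) (y∈X′ , sy) = simplicial x∈X′ y∈X′ sx sy

    module _ (D : Orientation G) where
      open Walks (Arc D)

      Out In : Pred (Fin n) 0ℓ
      Out w = DependentIn D X (s , w)
      In  w = DependentIn D X (w , s)

      Out? : Decidable Out
      Out? w = dependentIn? D X (s , w)

      In? : Decidable In
      In? w = dependentIn? D X (w , s)

      Gained? : Decidable (DependentIn D X ∖ DependentIn D X′)
      Gained? = dependentIn? D X ∩? ∁? (dependentIn? D X′)

      AtS? : Decidable (DependentFrom D X s ∪ DependentTo D X s)
      AtS? = dependentFrom? D X s ∪? dependentTo? D X s

      dependents-∷ : dependents X D ≡ dependents X′ D + Arcs.count Gained?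
      dependents-∷ = Arcs.count-∖ (dependentIn? D X′) (dependentIn? D X) λ (uv , k , p) → uv , k , map there p

      count-at-s : Arcs.count AtS? ≡ V.count Out? + V.count In?
      count-at-s = trans
        (Arcs.count-∪ (dependentFrom? D X s) (dependentTo? D X s)
          λ { _ ((refl , ss , _) , (refl , _)) → Adj-irrefl (Arc⇒Adj D ss) refl })
        (cong₂ _+_ (count-dependentFrom D X s) (count-dependentTo D X s))

      triangle : ∀ {Y x y z} → x ∈ Y → y ∈ Y → z ∈ Y → Arc D x y → Arc D y z → Arc D x z →
                 DependentIn D Y (x , z)
      triangle x∈Y y∈Y z∈Y xy yz xz = xz , 0 , cons x∈Y xy (cons y∈Y yz (nil z∈Y))

      at-s-gained : DependentFrom D X s ∪ DependentTo D X s ⊆ DependentIn D X ∖ DependentIn D X′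
      at-s-gained (inj₁ (refl , dep)) = dep , λ (_ , _ , p) → s∉X′ (start-in p)
      at-s-gained (inj₂ (refl , dep)) = dep , λ (_ , _ , p) → s∉X′ (end-in p)

      LoneOut LoneIn : Pred (Fin n) 0ℓ
      LoneOut w = N w × Arc D s w × ¬ Out w
      LoneIn  w = N w × Arc D w s × ¬ In w

      LoneOut? : Decidable LoneOut
      LoneOut? w = N? w ×-dec (Arc? D s w ×-dec ¬? (Out? w))

      LoneIn? : Decidable LoneIn
      LoneIn? w = N? w ×-dec (Arc? D w s ×-dec ¬? (In? w))

      lone-out-unique : ∀ {i j} → LoneOut i → LoneOut j → i ≡ j
      lone-out-unique {i} {j} (Ni , si , ¬Oi) (Nj , sj , ¬Oj) = decidable-stable (i ≟ j) λ i≢j →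
        [ (λ ij → ¬Oj (triangle (here refl) (there (proj₁ Ni)) (there (proj₁ Nj)) si ij sj))
        , (λ ji → ¬Oi (triangle (here refl) (there (proj₁ Nj)) (there (proj₁ Ni)) sj ji si))
        ] (Adj⇒Arc D (N-clique Ni Nj i≢j))

      lone-in-unique : ∀ {i j} → LoneIn i → LoneIn j → i ≡ j
      lone-in-unique {i} {j} (Ni , is , ¬Ii) (Nj , js , ¬Ij) = decidable-stable (i ≟ j) λ i≢j →
        [ (λ ij → ¬Ii (triangle (there (proj₁ Ni)) (there (proj₁ Nj)) (here refl) ij js is))
        , (λ ji → ¬Ij (triangle (there (proj₁ Nj)) (there (proj₁ Ni)) (here refl) ji is js))
        ] (Adj⇒Arc D (N-clique Ni Nj i≢j))

      N-classified : N ⊆ (LoneOut ∪ LoneIn) ∪ (Out ∪ In)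
      N-classified {w} Nw with Adj⇒Arc D (proj₂ Nw) | Out? w | In? w
      ... | inj₁ sw | yes out | _        = inj₂ (inj₁ out)
      ... | inj₁ sw | no ¬out | _        = inj₁ (inj₁ (Nw , sw , ¬out))
      ... | inj₂ ws | _       | yes into = inj₂ (inj₂ into)
      ... | inj₂ ws | _       | no ¬into = inj₁ (inj₂ (Nw , ws , ¬into))

      degree≤2+out+in : degree ≤ 2 + (V.count Out? + V.count In?)
      degree≤2+out+in = begin
        degree                                                 ≤⟨ V.count-mono N? _ N-classified ⟩
        V.count ((LoneOut? ∪? LoneIn?) ∪? (Out? ∪? In?))       ≤⟨ V.count-∪-≤ (LoneOut? ∪? LoneIn?) _ ⟩
        V.count (LoneOut? ∪? LoneIn?) + V.count (Out? ∪? In?)  ≤⟨ +-mono-≤ lone≤2 (V.count-∪-≤ Out? In?) ⟩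
        2 + (V.count Out? + V.count In?)                       ∎
        where
        open ≤-Reasoning
        lone≤2 : V.count (LoneOut? ∪? LoneIn?) ≤ 2
        lone≤2 = ≤-trans (V.count-∪-≤ LoneOut? LoneIn?)
          (+-mono-≤ (V.count-subsingleton LoneOut? lone-out-unique) (V.count-subsingleton LoneIn? lone-in-unique))

      dependents-lower : dependents X′ D + (degree ∸ 2) ≤ dependents X D
      dependents-lower = begin
        dependents X′ D + (degree ∸ 2)               ≤⟨ +-monoʳ-≤ (dependents X′ D) degree∸2≤gained ⟩
        dependents X′ D + Arcs.count Gained?         ≡⟨ dependents-∷ ⟨
        dependents X D                               ∎
        where
        open ≤-Reasoning
        degree∸2≤gained : degree ∸ 2 ≤ Arcs.count Gained?
        degree∸2≤gained = begin
          degree ∸ 2                    ≤⟨ m≤n+o⇒m∸n≤o degree 2 degree≤2+out+in ⟩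
          V.count Out? + V.count In?    ≡⟨ count-at-s ⟨
          Arcs.count AtS?               ≤⟨ Arcs.count-mono AtS? Gained? at-s-gained ⟩
          Arcs.count Gained?            ∎

      module _ (acyclic : Acyclic G D) where

        no-cycle : ∀ {P x k} → ¬ WalkIn P x x (suc k)
        no-cycle = acyclic⇒no-closed-walk D acyclic

        through-s : ∀ {x y} → Arc D x s → Arc D s y → x ∈ X′ → y ∈ X′ → Arc D x y
        through-s xs sy x∈X′ y∈X′ =
          [ id , (λ yx → ⊥-elim (no-cycle (cons tt xs (cons tt sy (cons tt yx (nil tt)))))) ]
          (Adj⇒Arc D (simplicial x∈X′ y∈X′ (Adj-sym (Arc⇒Adj D xs)) (Arc⇒Adj D sy)
                                 λ { refl → no-cycle (cons tt xs (cons tt sy (nil tt))) }))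

        leaving-s : ∀ {w y k} → Arc D s w → WalkIn (_∈ X) w y k → WalkIn (_∈ X′) w y k
        leaving-s sw p = map (λ (z∈X , z≢s) → ∈X′ z∈X z≢s) (avoiding s (λ back → no-cycle (cons (here refl) sw back)) p)

        -- s occurs at most once on an acyclic walk, and its detour u → s → w is replaced by u → w.
        bypass : ∀ {x y k} → x ≢ s → y ≢ s → WalkIn (_∈ X) x y (suc k) →
                 ∃ λ k′ → k ≤ suc k′ × WalkIn (_∈ X′) x y (suc k′)
        bypass x≢s y≢s (cons x∈X xw (nil y∈X)) = 0 , z≤n , cons (∈X′ x∈X x≢s) xw (nil (∈X′ y∈X y≢s))
        bypass x≢s y≢s (cons x∈X xw (cons {x = w} w∈X ww′ rest)) with w ≟ s
        ... | yes refl = _ , ≤-refl ,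
          cons (∈X′ x∈X x≢s) (through-s xw ww′ (∈X′ x∈X x≢s) (start-in (leaving-s ww′ rest))) (leaving-s ww′ rest)
        ... | no w≢s with bypass w≢s y≢s (cons w∈X ww′ rest)
        ...   | k′ , k≤1+k′ , p = suc k′ , s≤s k≤1+k′ , cons (∈X′ x∈X x≢s) xw p

        New : Pred (Fin n × Fin n) 0ℓ
        New (u , v) = u ≢ s × v ≢ s × DependentIn D X (u , v) × ¬ DependentIn D X′ (u , v)

        New? : Decidable New
        New? (u , v) = ¬? (u ≟ s) ×-dec (¬? (v ≟ s) ×-dec Gained? (u , v))

        new-through-s : ∀ {a b} → New (a , b) → Arc D a s × Arc D s b × a ∈ X′ × b ∈ X′
        new-through-s (a≢s , b≢s , (ab , k , cons {w = m} a∈X am (cons m∈X mm′ rest)) , ¬dep′) with m ≟ s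
        new-through-s (a≢s , b≢s , (ab , _ , cons a∈X as (cons _ sb (nil b∈X))) , ¬dep′) | yes refl =
          as , sb , ∈X′ a∈X a≢s , ∈X′ b∈X b≢s
        new-through-s (a≢s , b≢s , (ab , _ , cons a∈X as (cons _ sm′ rest@(cons _ _ _))) , ¬dep′) | yes refl =
          ⊥-elim (¬dep′ (ab , _ , cons (∈X′ a∈X a≢s)
            (through-s as sm′ (∈X′ a∈X a≢s) (start-in (leaving-s sm′ rest))) (leaving-s sm′ rest)))
        ... | no m≢s with bypass m≢s b≢s (cons m∈X mm′ rest)
        ...   | k′ , _ , p = ⊥-elim (¬dep′ (ab , k′ , cons (∈X′ a∈X a≢s) am p))

        new-not-out : ∀ {a b} → New (a , b) → ¬ Out b
        new-not-out new@(_ , _ , (ab , _) , ¬dep′) (_ , k , cons _ sw rest) with new-through-s new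
        ... | as , _ , a∈X′ , _ =
          ¬dep′ (ab , k , cons a∈X′ (through-s as sw a∈X′ (start-in (leaving-s sw rest))) (leaving-s sw rest))

        new-unique : ∀ {p q} → New p → New q → p ≡ q
        new-unique {a , b} {a′ , b′} new new′ with new-through-s new | new-through-s new′
        ... | as , sb , a∈X′ , b∈X′ | a′s , sb′ , a′∈X′ , b′∈X′ = cong₂ _,_ same-source same-target
          where
          ¬dep : ¬ DependentIn D X′ (a , b)
          ¬dep = proj₂ (proj₂ (proj₂ new))
          ¬dep′ : ¬ DependentIn D X′ (a′ , b′)
          ¬dep′ = proj₂ (proj₂ (proj₂ new′))
          a→b : Arc D a b
          a→b = through-s as sb a∈X′ b∈X′
          a→b′ : Arc D a b′
          a→b′ = through-s as sb′ a∈X′ b′∈X′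
          a′→b : Arc D a′ b
          a′→b = through-s a′s sb a′∈X′ b∈X′
          a′→b′ : Arc D a′ b′
          a′→b′ = through-s a′s sb′ a′∈X′ b′∈X′
          same-source : a ≡ a′
          same-source = decidable-stable (a ≟ a′) λ a≢a′ →
            [ (λ aa′ → ¬dep  (triangle a∈X′ a′∈X′ b∈X′ aa′ a′→b a→b))
            , (λ a′a → ¬dep′ (triangle a′∈X′ a∈X′ b′∈X′ a′a a→b′ a′→b′))
            ] (Adj⇒Arc D (N-clique (a∈X′ , Adj-sym (Arc⇒Adj D as)) (a′∈X′ , Adj-sym (Arc⇒Adj D a′s)) a≢a′))
          same-target : b ≡ b′
          same-target = decidable-stable (b ≟ b′) λ b≢b′ →
            [ (λ bb′ → ¬dep′ (triangle a′∈X′ b∈X′ b′∈X′ a′→b bb′ a′→b′))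
            , (λ b′b → ¬dep  (triangle a∈X′ b′∈X′ b∈X′ a→b′ b′b a→b))
            ] (Adj⇒Arc D (N-clique (b∈X′ , Arc⇒Adj D sb) (b′∈X′ , Arc⇒Adj D sb′) b≢b′))

        out-in-⊆N : Out ∪ In ⊆ N
        out-in-⊆N (inj₁ (sw , _ , cons _ _ rest)) =
          ∈X′ (end-in rest) (λ { refl → Adj-irrefl (Arc⇒Adj D sw) refl }) , Arc⇒Adj D sw
        out-in-⊆N (inj₂ (ws , _ , p)) =
          ∈X′ (start-in p) (λ { refl → Adj-irrefl (Arc⇒Adj D ws) refl }) , Adj-sym (Arc⇒Adj D ws)

        count-out-in : V.count (Out? ∪? In?) ≡ V.count Out? + V.count In?
        count-out-in = V.count-∪ Out? In? λ { _ ((sw , _) , (ws , _)) → Arc-asym D sw ws }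

        gained-classified : DependentIn D X ∖ DependentIn D X′ ⊆ New ∪ (DependentFrom D X s ∪ DependentTo D X s)
        gained-classified {u , v} gained with u ≟ s | v ≟ s
        ... | yes refl | _        = inj₂ (inj₁ (refl , proj₁ gained))
        ... | no _     | yes refl = inj₂ (inj₂ (refl , proj₁ gained))
        ... | no u≢s   | no v≢s   = inj₁ (u≢s , v≢s , gained)

        gained≤new+out+in : Arcs.count Gained? ≤ Arcs.count New? + (V.count Out? + V.count In?)
        gained≤new+out+in = begin
          Arcs.count Gained?                  ≤⟨ Arcs.count-mono Gained? (New? ∪? AtS?) gained-classified ⟩
          Arcs.count (New? ∪? AtS?)           ≤⟨ Arcs.count-∪-≤ New? AtS? ⟩
          Arcs.count New? + Arcs.count AtS?   ≡⟨ cong (Arcs.count New? +_) count-at-s ⟩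
          Arcs.count New? + (V.count Out? + V.count In?) ∎
          where open ≤-Reasoning

        no-new-bound : Empty New → Arcs.count New? + (V.count Out? + V.count In?) ≤ degree
        no-new-bound no-new = begin
          Arcs.count New? + (V.count Out? + V.count In?)  ≡⟨ cong (_+ _) (Arcs.count-empty New? no-new) ⟩
          V.count Out? + V.count In?                      ≡⟨ count-out-in ⟨
          V.count (Out? ∪? In?)                           ≤⟨ V.count-mono (Out? ∪? In?) N? out-in-⊆N ⟩
          degree                                          ∎
          where open ≤-Reasoning

        new-bound : ∀ {a b} → New (a , b) → Arcs.count New? + (V.count Out? + V.count In?) ≤ degree
        new-bound {a} {b} new = begin
          Arcs.count New? + (V.count Out? + V.count In?)  ≤⟨ +-monoˡ-≤ _ (Arcs.count-subsingleton New? new-unique) ⟩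
          1 + (V.count Out? + V.count In?)                ≡⟨ cong₂ _+_ (V.count-singleton (_≟ b) refl id) count-out-in ⟨
          V.count (_≟ b) + V.count (Out? ∪? In?)          ≡⟨ V.count-∪ (_≟ b) (Out? ∪? In?) disjoint ⟨
          V.count ((_≟ b) ∪? (Out? ∪? In?))               ≤⟨ V.count-mono _ N? b-out-in-⊆N ⟩
          degree                                          ∎
          where
          open ≤-Reasoning
          sb : Arc D s b
          sb = proj₁ (proj₂ (new-through-s new))
          b-out-in-⊆N : (_≡ b) ∪ (Out ∪ In) ⊆ N
          b-out-in-⊆N (inj₁ refl)   = proj₂ (proj₂ (proj₂ (new-through-s new))) , Arc⇒Adj D sb
          b-out-in-⊆N (inj₂ out-in) = out-in-⊆N out-in
          disjoint : Empty ((_≡ b) ∩ (Out ∪ In))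
          disjoint _ (refl , inj₁ out)      = new-not-out new out
          disjoint _ (refl , inj₂ (bs , _)) = Arc-asym D bs sb

        new+out+in≤degree : Arcs.count New? + (V.count Out? + V.count In?) ≤ degree
        new+out+in≤degree = by-cases (any? λ a → any? λ b → New? (a , b))
          where
          by-cases : Dec (∃ λ a → ∃ λ b → New (a , b)) → Arcs.count New? + (V.count Out? + V.count In?) ≤ degree
          by-cases (yes (_ , _ , new)) = new-bound new
          by-cases (no none)           = no-new-bound λ (a , b) new → none (a , b , new)

        dependents-upper : dependents X D ≤ dependents X′ D + degree
        dependents-upper = begin
          dependents X D                                                      ≡⟨ dependents-∷ ⟩
          dependents X′ D + Arcs.count Gained?                                ≤⟨ +-monoʳ-≤ _ gained≤new+out+in ⟩
          dependents X′ D + (Arcs.count New? + (V.count Out? + V.count In?))  ≤⟨ +-monoʳ-≤ _ new+out+in≤degree ⟩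
          dependents X′ D + degree                                            ∎
          where open ≤-Reasoning

    module _ (D′ : Orientation G) (acyclic′ : Acyclic G D′) where

      source-arc : Fin n → Fin n → Bool
      source-arc u v with u ≟ s | v ≟ s
      ... | yes _ | _     = adj s v
      ... | no _  | yes _ = false
      ... | no _  | no _  = arc D′ u v

      source-arc-from : ∀ v → source-arc s v ≡ adj s v
      source-arc-from v with s ≟ s
      ... | yes _  = refl
      ... | no s≢s = ⊥-elim (s≢s refl)

      source-arc-to : ∀ u → source-arc u s ≡ false
      source-arc-to u with u ≟ s | s ≟ s
      ... | yes refl | _      = loopless s
      ... | no _     | yes _  = refl
      ... | no _     | no s≢s = ⊥-elim (s≢s refl)

      source-arc-away : ∀ {u v} → u ≢ s → v ≢ s → source-arc u v ≡ arc D′ u v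
      source-arc-away {u} {v} u≢s v≢s with u ≟ s | v ≟ s
      ... | yes u≡s | _       = ⊥-elim (u≢s u≡s)
      ... | no _    | yes v≡s = ⊥-elim (v≢s v≡s)
      ... | no _    | no _    = refl

      source-arc⇒Adj : ∀ u v → source-arc u v ≡ true → Adj G u v
      source-arc⇒Adj u v uv = by-cases (u ≟ s) (v ≟ s)
        where
        by-cases : Dec (u ≡ s) → Dec (v ≡ s) → Adj G u v
        by-cases (yes refl) _          = trans (sym (source-arc-from v)) uv
        by-cases (no u≢s)   (no v≢s)   = arc⇒edge D′ u v (trans (sym (source-arc-away u≢s v≢s)) uv)
        by-cases (no _)     (yes refl) with trans (sym (source-arc-to u)) uv
        ... | ()

      source-arc-oneDir : ∀ u v → Adj G u v → source-arc u v ≡ not (source-arc v u)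
      source-arc-oneDir u v uv = by-cases (u ≟ s) (v ≟ s)
        where
        by-cases : Dec (u ≡ s) → Dec (v ≡ s) → source-arc u v ≡ not (source-arc v u)
        by-cases (yes refl) _          = trans (source-arc-from v) (trans uv (cong not (sym (source-arc-to v))))
        by-cases (no _)     (yes refl) = trans (source-arc-to u) (cong not (sym (trans (source-arc-from u) (Adj-sym uv))))
        by-cases (no u≢s)   (no v≢s)   =
          trans (source-arc-away u≢s v≢s) (trans (oneDir D′ u v uv) (cong not (sym (source-arc-away v≢s u≢s))))

      source : Orientation G
      source = record { arc = source-arc ; arc⇒edge = source-arc⇒Adj ; oneDir = source-arc-oneDir }

      private
        module S  = Walks (Arc source)
        module W′ = Walks (Arc D′)

      no-arc-into-s : ∀ u → ¬ Arc source u s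
      no-arc-into-s u us with trans (sym (source-arc-to u)) us
      ... | ()

      arc-from-s : ∀ {v} → Adj G s v → Arc source s v
      arc-from-s {v} sv = trans (source-arc-from v) sv

      arc-away : ∀ {u v} → u ≢ s → v ≢ s → Arc D′ u v → Arc source u v
      arc-away u≢s v≢s uv = trans (source-arc-away u≢s v≢s) uv

      arc-away⁻ : ∀ {u v} → u ≢ s → v ≢ s → Arc source u v → Arc D′ u v
      arc-away⁻ u≢s v≢s uv = trans (sym (source-arc-away u≢s v≢s)) uv

      walk-avoiding-s : ∀ {P x y k} → x ≢ s → S.WalkIn P x y k → W′.WalkIn (λ z → P z × z ≢ s) x y k
      walk-avoiding-s x≢s (S.nil p)                    = W′.nil (p , x≢s)
      walk-avoiding-s {x = x} x≢s (S.cons {w = w} p xw rest) =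
        W′.cons (p , x≢s) (arc-away⁻ x≢s w≢s xw) (walk-avoiding-s w≢s rest)
        where
        w≢s : w ≢ s
        w≢s refl = no-arc-into-s x xw

      walk-avoiding-s⁻ : ∀ {P x y k} → (∀ {z} → P z → z ≢ s) → W′.WalkIn P x y k → S.WalkIn P x y k
      walk-avoiding-s⁻ avoids (W′.nil p)         = S.nil p
      walk-avoiding-s⁻ avoids (W′.cons p xw rest) =
        S.cons p (arc-away (avoids p) (avoids (W′.start-in rest)) xw) (walk-avoiding-s⁻ avoids rest)

      end≢s : ∀ {P x y k} → S.WalkIn P x y (suc k) → y ≢ s
      end≢s (S.cons {x = x} _ xy (S.nil _)) refl = no-arc-into-s x xy
      end≢s (S.cons _ _ rest@(S.cons _ _ _))      = end≢s rest

      source-acyclic : Acyclic G source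
      source-acyclic v k cycle = acyclic′ v k (toWalk D′ (walk-avoiding-s (end≢s closed) closed))
        where
        closed : S.WalkIn (λ _ → ⊤) v v (suc k)
        closed = fromWalk source (λ _ → tt) cycle

      dependent-kept : DependentIn D′ X′ ⊆ DependentIn source X
      dependent-kept (uv , k , p) =
        arc-away (∈X′⇒≢s (W′.start-in p)) (∈X′⇒≢s (W′.end-in p)) uv , k , S.map there (walk-avoiding-s⁻ ∈X′⇒≢s p)

      dependent-kept⁻ : ∀ {u v} → u ≢ s → DependentIn source X (u , v) → DependentIn D′ X′ (u , v)
      dependent-kept⁻ u≢s (uv , k , p) =
        arc-away⁻ u≢s (end≢s p) uv , k , W′.map (λ (z∈X , z≢s) → ∈X′ z∈X z≢s) (walk-avoiding-s u≢s p)

      gained-from-s : DependentIn source X ∖ DependentIn D′ X′ ⊆ DependentFrom source X s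
      gained-from-s {u , v} (dep , ¬dep′) = by-cases (u ≟ s)
        where
        by-cases : Dec (u ≡ s) → DependentFrom source X s (u , v)
        by-cases (yes refl) = refl , dep
        by-cases (no u≢s)   = ⊥-elim (¬dep′ (dependent-kept⁻ u≢s dep))

      from-s-gained : DependentFrom source X s ⊆ DependentIn source X ∖ DependentIn D′ X′
      from-s-gained (refl , dep) = dep , λ (_ , _ , p) → s∉X′ (W′.start-in p)

      from-s⇒N : ∀ {v} → DependentIn source X (s , v) → N v
      from-s⇒N {v} (sv , _ , S.cons _ _ rest) = ∈X′ (S.end-in rest) (end≢s rest) , source-arc⇒Adj s v sv

      module _ {m : Fin n} (Nm : N m) (m-source : ∀ {w} → N w → w ≢ m → Arc D′ m w) where

        from-s⇒N∖m : ∀ {v} → DependentIn source X (s , v) → N v × v ≢ m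
        from-s⇒N∖m {v} dep@(_ , k , S.cons {w = w} _ sw rest) = from-s⇒N dep , v≢m
          where
          w≢s : w ≢ s
          w≢s refl = no-arc-into-s s sw
          w⇝v : W′.WalkIn (λ z → z ∈ X × z ≢ s) w v (suc k)
          w⇝v = walk-avoiding-s w≢s rest
          v≢m : v ≢ m
          v≢m refl with w ≟ m
          ... | yes refl = acyclic⇒no-closed-walk D′ acyclic′ w⇝v
          ... | no w≢m   = acyclic⇒no-closed-walk D′ acyclic′
            (W′.cons (W′.end-in w⇝v) (m-source (∈X′ (S.start-in rest) w≢s , source-arc⇒Adj s w sw) w≢m) w⇝v)

        N∖m⇒from-s : ∀ {v} → N v × v ≢ m → DependentIn source X (s , v)
        N∖m⇒from-s ((v∈X′ , sv) , v≢m) = arc-from-s sv , 0 ,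
          S.cons (here refl) (arc-from-s (proj₂ Nm))
            (S.cons (there (proj₁ Nm)) (arc-away (∈X′⇒≢s (proj₁ Nm)) (∈X′⇒≢s v∈X′) (m-source (v∈X′ , sv) v≢m))
              (S.nil (there v∈X′)))

      count-from-s-empty : Empty N → V.count (Out? source) ≡ degree ∸ 1
      count-from-s-empty N-empty = trans
        (V.count-empty (Out? source) λ v dep → N-empty v (from-s⇒N dep))
        (cong (_∸ 1) (sym (V.count-empty N? N-empty)))

      count-from-s-source : ∀ {m} → N m → (∀ {w} → N w → w ≢ m → Arc D′ m w) → V.count (Out? source) ≡ degree ∸ 1
      count-from-s-source {m} Nm m-source = begin
        V.count (Out? source)                  ≡⟨ V.count-cong (Out? source) N∖m? from-s⇔N∖m ⟩
        V.count N∖m?                           ≡⟨⟩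
        (1 + V.count N∖m?) ∸ 1                 ≡⟨ cong (λ c → (c + V.count N∖m?) ∸ 1) (V.count-singleton (_≟ m) refl id) ⟨
        (V.count (_≟ m) + V.count N∖m?) ∸ 1    ≡⟨ cong (_∸ 1) (V.count-∖ (_≟ m) N? λ { refl → Nm }) ⟨
        degree ∸ 1                             ∎
        where
        open ≡-Reasoning
        N∖m? : Decidable (N ∖ (_≡ m))
        N∖m? = N? ∩? ∁? (_≟ m)
        from-s⇔N∖m : (λ v → DependentIn source X (s , v)) ≐ N ∖ (_≡ m)
        from-s⇔N∖m = from-s⇒N∖m Nm m-source , N∖m⇒from-s Nm m-source

      count-from-s : V.count (Out? source) ≡ degree ∸ 1
      count-from-s = [ count-from-s-empty , (λ (_ , Nm , m-source) → count-from-s-source Nm m-source) ]′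
                       (clique-source acyclic′ N? N-clique)

      dependents-source : dependents X source ≡ dependents X′ D′ + (degree ∸ 1)
      dependents-source = begin
        dependents X source
          ≡⟨ Arcs.count-∖ (dependentIn? D′ X′) (dependentIn? source X) dependent-kept ⟩
        dependents X′ D′ + Arcs.count (dependentIn? source X ∩? ∁? (dependentIn? D′ X′))
          ≡⟨ cong (dependents X′ D′ +_) (Arcs.count-cong _ (dependentFrom? source X s) (gained-from-s , from-s-gained)) ⟩
        dependents X′ D′ + Arcs.count (dependentFrom? source X s)
          ≡⟨ cong (dependents X′ D′ +_) (trans (count-dependentFrom source X s) count-from-s) ⟩
        dependents X′ D′ + (degree ∸ 1)
          ∎
        where open ≡-Reasoning

shift-into : ∀ {a′ a d b b′} t → a′ + (t ∸ 2) ≤ a → a < d → d < b → b ≤ b′ + t →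
             ∃ λ d′ → a′ ≤ d′ × d′ ≤ b′ × d′ + (t ∸ 1) ≡ d
shift-into {a′} {a} {d} {b} {b′} t a′+t∸2≤a a<d d<b b≤b′+t =
  d ∸ (t ∸ 1) , m+n≤o⇒m≤o∸n a′ lower , m≤n+o⇒m∸n≤o d (t ∸ 1) upper , m∸n+n≡m (m+n≤o⇒n≤o a′ lower)
  where
  open ≤-Reasoning
  t∸1≤1+t∸2 : ∀ t → t ∸ 1 ≤ suc (t ∸ 2)
  t∸1≤1+t∸2 zero          = z≤n
  t∸1≤1+t∸2 (suc zero)    = z≤n
  t∸1≤1+t∸2 (suc (suc t)) = ≤-refl
  lower : a′ + (t ∸ 1) ≤ d
  lower = begin
    a′ + (t ∸ 1)        ≤⟨ +-monoʳ-≤ a′ (t∸1≤1+t∸2 t) ⟩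
    a′ + suc (t ∸ 2)    ≡⟨ +-suc a′ (t ∸ 2) ⟩
    suc (a′ + (t ∸ 2))  ≤⟨ s≤s a′+t∸2≤a ⟩
    suc a               ≤⟨ a<d ⟩
    d                   ∎
  upper : d ≤ (t ∸ 1) + b′
  upper = ≤-pred (begin
    suc d               ≤⟨ d<b ⟩
    b                   ≤⟨ b≤b′+t ⟩
    b′ + t              ≡⟨ +-comm b′ t ⟩
    t + b′              ≤⟨ +-monoˡ-≤ b′ (m≤n+m∸n t 1) ⟩
    suc (t ∸ 1) + b′    ∎)

module FullOrientability (G : Graph) (chordal : Chordal G) where
  open Graph G using (n)
  open GraphFacts G
  open ChordalGraphs G chordal
  open Orientations G
  open AddingSimplicialVertex G

  Attainable : List (Fin n) → ℕ → Set
  Attainable X d = ∃ λ D → Acyclic G D × dependents X D ≡ d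

  dependents-[] : ∀ D → dependents [] D ≡ 0
  dependents-[] D = Arcs.count-empty (dependentIn? D []) λ { _ (_ , _ , Walks.cons () _ _) }

  module _ {D₁ D₂ : Orientation G} (acyclic₁ : Acyclic G D₁) (acyclic₂ : Acyclic G D₂)
           {s : Fin n} {X′ : List (Fin n)} (s∉X′ : s ∉ X′) (simplicial : IsSimplicial (_∈ X′) s)
           {d : ℕ} (d₁<d : dependents (s ∷ X′) D₁ < d) (d<d₂ : d < dependents (s ∷ X′) D₂) where

    shifted : ∃ λ d′ → dependents X′ D₁ ≤ d′ × d′ ≤ dependents X′ D₂ × d′ + (degree s∉X′ simplicial ∸ 1) ≡ d
    shifted = shift-into (degree s∉X′ simplicial) (dependents-lower s∉X′ simplicial D₁) d₁<d d<d₂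
                         (dependents-upper s∉X′ simplicial D₂ acyclic₂)

    attain-∷ : (∀ {d′} → dependents X′ D₁ ≤ d′ → d′ ≤ dependents X′ D₂ → Attainable X′ d′) →
               Attainable (s ∷ X′) d
    attain-∷ IH = extend shifted
      where
      extend : (∃ λ d′ → dependents X′ D₁ ≤ d′ × d′ ≤ dependents X′ D₂ × d′ + (degree s∉X′ simplicial ∸ 1) ≡ d) →
               Attainable (s ∷ X′) d
      extend (d′ , d₁′≤d′ , d′≤d₂′ , d′+t∸1≡d) with IH d₁′≤d′ d′≤d₂′
      ... | D′ , acyclic′ , dependents≡d′ =
        source s∉X′ simplicial D′ acyclic′ , source-acyclic s∉X′ simplicial D′ acyclic′ ,
        trans (dependents-source s∉X′ simplicial D′ acyclic′)
              (trans (cong (_+ (degree s∉X′ simplicial ∸ 1)) dependents≡d′) d′+t∸1≡d)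

  module _ {D₁ D₂ : Orientation G} (acyclic₁ : Acyclic G D₁) (acyclic₂ : Acyclic G D₂) where

    intermediate-values : ∀ {X} → PerfectEliminationOrdering X → ∀ {d} →
                          dependents X D₁ ≤ d → d ≤ dependents X D₂ → Attainable X d
    intermediate-values [] _ d≤0 =
      D₁ , acyclic₁ , trans (dependents-[] D₁) (sym (n≤0⇒n≡0 (subst (_ ≤_) (dependents-[] D₂) d≤0)))
    intermediate-values {s ∷ X′} ((s∉X′ , simplicial) ∷ peo) {d} d₁≤d d≤d₂ =
      by-cases (dependents (s ∷ X′) D₁ ℕ.≟ d) (d ℕ.≟ dependents (s ∷ X′) D₂)
      where
      by-cases : Dec (dependents (s ∷ X′) D₁ ≡ d) → Dec (d ≡ dependents (s ∷ X′) D₂) → Attainable (s ∷ X′) d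
      by-cases (yes d₁≡d) _          = D₁ , acyclic₁ , d₁≡d
      by-cases (no _)     (yes d≡d₂) = D₂ , acyclic₂ , sym d≡d₂
      by-cases (no d₁≢d)  (no d≢d₂)  =
        attain-∷ acyclic₁ acyclic₂ s∉X′ simplicial (≤∧≢⇒< d₁≤d d₁≢d) (≤∧≢⇒< d≤d₂ d≢d₂) (intermediate-values peo)

theorem4 : (G : Graph) → Chordal G → FullyOrientable G
theorem4 G chordal d D₁ D₂ a b acyclic₁ a-dependents acyclic₂ b-dependents a≤d d≤b =
  from-ordering perfect-elimination-ordering
  where
  open Graph G using (n)
  open ChordalGraphs G chordal
  open Orientations G
  open FullOrientability G chordal
  from-ordering : (∃ λ σ → PerfectEliminationOrdering σ × ∀ x → x ∈ σ) → ∃ λ D → Acyclic G D × NumDependent G D d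
  from-ordering (σ , peo , σ-complete) with intermediate-values acyclic₁ acyclic₂ peo
    (subst (_≤ d) (NumDependent⇒≡dependents σ-complete D₁ a-dependents) a≤d)
    (subst (d ≤_) (NumDependent⇒≡dependents σ-complete D₂ b-dependents) d≤b)
  ... | D , acyclic , dependents≡d =
    D , acyclic , subst (NumDependent G D) dependents≡d (NumDependent-dependents σ-complete D)
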